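{- Let $f: A^*\to B^*$ be a non-erasing morphism and let $\mathbf{w}$ be an infinite word over $A$ such that $f(\mathbf{w})$ is $q$-quasiperiodic for some non-empty word $q$ with $2|q|\le|f(\alpha)|$ for every letter $\alpha\in A$. Then either (1) $\mathbf{w}=(a_1\cdots a_k)^\omega$ for some pairwise distinct letters $a_1,\dots,a_k$; or (2) there exist finite words $x,y,z$ and letters $a,b$ such that $|xyz|_a=0$, $|z|_b=0$, the infinite word $xay(bz)^\omega$ is not quasiperiodic, and $f(xay(bz)^\omega)$ is $q$-quasiperiodic; moreover, in this case $x,y,z$ can be chosen so that every letter occurs at most once in each of $x$, $y$ and $z$.
   Context: $|u|_a$ is the number of occurrences of the letter $a$ in $u$; $x^\omega$ denotes $xxx\cdots$. For a non-empty word $q$, an infinite word $\mathbf{x}$ is $q$-quasiperiodic if every position of $\mathbf{x}$ lies within some occurrence of $q$ in $\mathbf{x}$; it is quasiperiodic if it is $q$-quasiperiodic for some non-empty $q$. -}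

module Defs where

open import Data.Nat using (ℕ; zero; suc; _+_; _≤_; _<_)
open import Data.Nat.DivMod using (_mod_)
open import Data.Fin using (Fin; toℕ)
open import Data.List using (List; []; _∷_; length; lookup)
open import Data.List.NonEmpty using (List⁺; _∷_; head; tail)
open import Data.Product using (∃; _×_)
open import Relation.Binary.PropositionalEquality using (_≡_; _≢_)

Word∞ : Set → Set
Word∞ A = ℕ → A

-- A morphism A* → B* is determined by the images of the letters; it is
-- non-erasing iff every letter image is non-empty, so a non-erasing
-- morphism is represented by a map A → List⁺ B.

-- image f(w) of an infinite word under a non-erasing morphism:
-- go n b bs w = letter at position n of  b bs f(w 0) f(w 1) ...
go : {A B : Set} → (A → List⁺ B) → ℕ → B → List B → Word∞ A → B
go f zero    b bs       w = b
go f (suc n) b (c ∷ cs) w = go f n c cs w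
go f (suc n) b []       w = go f n (head (f (w 0))) (tail (f (w 0))) (λ i → w (suc i))

image : {A B : Set} → (A → List⁺ B) → Word∞ A → Word∞ B
image f w n = go f n (head (f (w 0))) (tail (f (w 0))) (λ i → w (suc i))

_⧺_ : {A : Set} → List A → Word∞ A → Word∞ A
([] ⧺ w) n = w n
((a ∷ as) ⧺ w) zero = a
((a ∷ as) ⧺ w) (suc n) = (as ⧺ w) n

infixr 5 _⧺_

omega : {A : Set} → List⁺ A → Word∞ A
omega (a ∷ as) n = lookup (a ∷ as) (n mod suc (length as))

OccursAt : {B : Set} → List B → Word∞ B → ℕ → Set
OccursAt q x j = ∀ (k : Fin (length q)) → x (j + toℕ k) ≡ lookup q k

QuasiperiodicBy : {B : Set} → List B → Word∞ B → Set
QuasiperiodicBy q x = ∀ (i : ℕ) → ∃ λ j → j ≤ i × i < j + length q × OccursAt q x j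

Quasiperiodic : {B : Set} → Word∞ B → Set
Quasiperiodic x = ∃ λ q → q ≢ [] × QuasiperiodicBy q x

-- Write ℓ = |q|. Since every letter image has length at least 2ℓ, an occurrence of q covering a
-- position ≥ ℓ of f(w) that lies in the image of w i sits inside f(w i w (i+1)). Hence
-- q-quasiperiodicity of f(w) is local: f(w 0) must cover its first ℓ positions by itself, and every
-- pair of consecutive letters of w must be an edge of a decidable graph Link on the alphabet; and
-- conversely these conditions make any image q-quasiperiodic.
--
-- It remains to show that an infinite walk w in a finite graph either is (a₁ ⋯ aₖ)^ω with distinct
-- letters, or can be replaced by a walk x a y (b z)^ω with the same first letter in which a occurs
-- exactly once, which makes it non-quasiperiodic. The first repetition w i = w k of w gives such a
-- lasso when i > 0. When i = 0, w starts on a cycle. If no edge leaves the cycle towards a letter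
-- from which a path of length |A| starts (a decidable stand-in for an infinite path, by
-- pigeonhole), w must run around the cycle forever; otherwise the first repetition along such a
-- deviating path yields a lasso.

module Submission where

open import Defs
open import Function using (_∘_)
open import Data.Nat using (ℕ; zero; suc; _+_; _*_; _≤_; _<_; z≤n; s≤s; NonZero; _%_; _/_)
open import Data.Nat.Properties
open import Data.Nat.Induction using (<-rec)
open import Data.Nat.DivMod using (_mod_; m%n<n; m<n⇒m%n≡m; n%n≡0; m≡m%n+[m/n]*n; [m+kn]%n≡m%n)
open import Data.Fin using (Fin; toℕ; fromℕ<)
open import Data.Fin.Properties using (toℕ-fromℕ<; toℕ<n; pigeonhole; any?; all?) renaming (_≟_ to _≟ᶠ_)
open import Data.List using (List; []; _∷_; length; _++_; lookup; applyUpTo)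
open import Data.List.Properties using (length-applyUpTo; lookup-applyUpTo)
open import Data.List.NonEmpty using (List⁺; toList; head; tail) renaming (_∷_ to _∷⁺_; length to length⁺)
open import Data.List.Membership.Propositional using (_∈_; _∉_)
open import Data.List.Membership.Propositional.Properties using (∈-lookup; ∈-++⁻; ∈-++⁺ˡ; ∈-++⁺ʳ; ∈-applyUpTo⁻)
open import Data.List.Relation.Unary.Any using (here; there)
open import Data.List.Relation.Unary.All.Properties using (All¬⇒¬Any)
open import Data.List.Relation.Unary.Unique.Propositional using (Unique)
open import Data.List.Relation.Unary.Unique.Propositional.Properties using (applyUpTo⁺₁)
import Data.List.Relation.Unary.AllPairs as AllPairs
open import Data.Product using (Σ; ∃; _×_; _,_)
open import Data.Sum using (_⊎_; inj₁; inj₂; [_,_]′)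
import Data.Sum as Sum
open import Data.Empty using (⊥-elim)
open import Data.Unit using (⊤; tt)
open import Relation.Nullary using (¬_; Dec; yes; no; ¬?; _×-dec_; _→-dec_; map′; decidable-stable)
open import Relation.Binary.PropositionalEquality
open import Relation.Binary.Definitions using (DecidableEquality; tri<; tri≈; tri>)

module _ {A : Set} where

  prefix : ℕ → Word∞ A → List A
  prefix k u = applyUpTo u k

  prefix⁺ : ℕ → Word∞ A → List⁺ A
  prefix⁺ n u = u 0 ∷⁺ prefix n (u ∘ suc)

  -- i + t rather than t + i, so that shift t u 0 reduces to u t.
  shift : ℕ → Word∞ A → Word∞ A
  shift t u i = u (i + t)

  InjectiveBelow : Word∞ A → ℕ → Set
  InjectiveBelow u n = ∀ {i j} → i < j → j < n → u i ≢ u j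

  injectiveBelow-≤ : ∀ {u m n} → m ≤ n → InjectiveBelow u n → InjectiveBelow u m
  injectiveBelow-≤ m≤n inj i<j j<m = inj i<j (<-≤-trans j<m m≤n)

  injectiveBelow-shift : ∀ {u K} t n → t + n ≤ K → InjectiveBelow u K → InjectiveBelow (shift t u) n
  injectiveBelow-shift t n t+n≤K inj {i} {j} i<j j<n =
    inj (+-monoˡ-< t i<j) (<-≤-trans (subst (j + t <_) (+-comm n t) (+-monoˡ-< t j<n)) t+n≤K)

  ⧺-prefix : ∀ {k i} (u v : Word∞ A) → i < k → (prefix k u ⧺ v) i ≡ u i
  ⧺-prefix {suc k} {zero}  u v _         = refl
  ⧺-prefix {suc k} {suc i} u v (s≤s i<k) = ⧺-prefix (u ∘ suc) v i<k

  ⧺-prefix-head : ∀ k (u v : Word∞ A) → u k ≡ v 0 → (prefix k u ⧺ v) 0 ≡ u 0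
  ⧺-prefix-head zero    u v uk≡v0 = sym uk≡v0
  ⧺-prefix-head (suc k) u v uk≡v0 = refl

  ⧺-prefix-+ : ∀ k (u v : Word∞ A) i → (prefix k u ⧺ v) (k + i) ≡ v i
  ⧺-prefix-+ zero    u v i = refl
  ⧺-prefix-+ (suc k) u v i = ⧺-prefix-+ k (u ∘ suc) v i

  ⧺-prefix-cases : ∀ k (u v : Word∞ A) i
                 → (i < k × (prefix k u ⧺ v) i ≡ u i) ⊎ ∃ λ j → i ≡ k + j × (prefix k u ⧺ v) i ≡ v j
  ⧺-prefix-cases zero    u v i       = inj₂ (i , refl , refl)
  ⧺-prefix-cases (suc k) u v zero    = inj₁ (s≤s z≤n , refl)
  ⧺-prefix-cases (suc k) u v (suc i) with ⧺-prefix-cases k (u ∘ suc) v i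
  ... | inj₁ (i<k , eq)     = inj₁ (s≤s i<k , eq)
  ... | inj₂ (j , i≡ , eq) = inj₂ (j , cong suc i≡ , eq)

  ⧺-length-+ : ∀ (xs : List A) v i → (xs ⧺ v) (length xs + i) ≡ v i
  ⧺-length-+ []       v i = refl
  ⧺-length-+ (x ∷ xs) v i = ⧺-length-+ xs v i

  ⧺-split : ∀ (xs : List A) v i → (xs ⧺ v) i ∈ xs ⊎ ∃ λ j → i ≡ length xs + j × (xs ⧺ v) i ≡ v j
  ⧺-split []       v i       = inj₂ (i , refl , refl)
  ⧺-split (x ∷ xs) v zero    = inj₁ (here refl)
  ⧺-split (x ∷ xs) v (suc i) with ⧺-split xs v i
  ... | inj₁ ∈xs           = inj₁ (there ∈xs)
  ... | inj₂ (j , i≡ , eq) = inj₂ (j , cong suc i≡ , eq)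

  omega-∈ : ∀ (b : A) z i → omega (b ∷⁺ z) i ∈ b ∷ z
  omega-∈ b z i = ∈-lookup {xs = b ∷ z} (i mod suc (length z))

  omega-prefix⁺ : ∀ n (u : Word∞ A) i → omega (prefix⁺ n u) i ≡ u (i % suc n)
  omega-prefix⁺ n u i = begin
    lookup (prefix (suc n) u) (i mod suc (length (prefix n (u ∘ suc))))
      ≡⟨ lookup-applyUpTo u (suc n) _ ⟩
    u (toℕ (i mod suc (length (prefix n (u ∘ suc)))))
      ≡⟨ cong u (toℕ-fromℕ< _) ⟩
    u (i % suc (length (prefix n (u ∘ suc))))
      ≡⟨ cong (λ k → u (i % suc k)) (length-applyUpTo (u ∘ suc) n) ⟩
    u (i % suc n) ∎
    where open ≡-Reasoning

suc-% : ∀ i p .{{_ : NonZero p}} → suc i % p ≡ suc (i % p) % p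
suc-% i p = begin
  suc i % p                        ≡⟨ cong (λ k → suc k % p) (m≡m%n+[m/n]*n i p) ⟩
  (suc (i % p) + (i / p) * p) % p  ≡⟨ [m+kn]%n≡m%n (suc (i % p)) (i / p) p ⟩
  suc (i % p) % p                  ∎
  where open ≡-Reasoning

-- The occurrence of q covering position p contains e; the one covering the position right after it
-- would contain e at the same offset, hence start at the same place.
unique-letter⇒¬quasiperiodic : ∀ {B : Set} (v : Word∞ B) {p e} → v p ≡ e → (∀ {i} → v i ≡ e → i ≡ p)
                             → ¬ Quasiperiodic v
unique-letter⇒¬quasiperiodic v {p} {e} vp≡e only-p (q , _ , qp) with qp p
... | j , j≤p , p<j+ℓ , occ with k , refl ← m≤n⇒∃[o]m+o≡n j≤p = n≮n (j + ℓ) j+ℓ<j+ℓ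
  where
  ℓ = length q
  k′ : Fin ℓ
  k′ = fromℕ< (+-cancelˡ-< j k ℓ p<j+ℓ)
  j+k′≡p : j + toℕ k′ ≡ j + k
  j+k′≡p = cong (j +_) (toℕ-fromℕ< _)
  q[k′]≡e : lookup q k′ ≡ e
  q[k′]≡e = trans (sym (occ k′)) (trans (cong v j+k′≡p) vp≡e)
  j+ℓ<j+ℓ : j + ℓ < j + ℓ
  j+ℓ<j+ℓ with j′ , _ , j+ℓ<j′+ℓ , occ′ ← qp (j + ℓ) =
    subst (λ i → j + ℓ < i + ℓ)
          (+-cancelʳ-≡ (toℕ k′) j′ j (trans (only-p (trans (occ′ k′) q[k′]≡e)) (sym j+k′≡p)))
          j+ℓ<j′+ℓ

module _ {A : Set} where

  lassoWord : List A → A → List A → A → List A → Word∞ A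
  lassoWord x a y b z = x ⧺ (a ∷ y) ⧺ omega (b ∷⁺ z)

  lassoWord-¬quasiperiodic : ∀ {x y z : List A} {a b} → a ∉ x ++ y ++ z → a ≢ b
                       → ¬ Quasiperiodic (lassoWord x a y b z)
  lassoWord-¬quasiperiodic {x} {y} {z} {a} {b} a∉xyz a≢b =
    unique-letter⇒¬quasiperiodic v v[|x|]≡a only-at-|x|
    where
    o = omega (b ∷⁺ z)
    v = lassoWord x a y b z
    v[|x|]≡a : v (length x) ≡ a
    v[|x|]≡a = trans (cong v (sym (+-identityʳ (length x)))) (⧺-length-+ x ((a ∷ y) ⧺ o) 0)
    a∉bz : a ∉ b ∷ z
    a∉bz (here a≡b)  = a≢b a≡b
    a∉bz (there a∈z) = a∉xyz (∈-++⁺ʳ x (∈-++⁺ʳ y a∈z))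
    only-at-|x| : ∀ {i} → v i ≡ a → i ≡ length x
    only-at-|x| {i} vi≡a with ⧺-split x ((a ∷ y) ⧺ o) i
    ... | inj₁ ∈x = ⊥-elim (a∉xyz (∈-++⁺ˡ (subst (_∈ x) vi≡a ∈x)))
    ... | inj₂ (zero , i≡ , _) = trans i≡ (+-identityʳ (length x))
    ... | inj₂ (suc j , _ , vi≡) with ⧺-split y o j
    ...   | inj₁ ∈y = ⊥-elim (a∉xyz (∈-++⁺ʳ x (∈-++⁺ˡ (subst (_∈ y) (trans (sym vi≡) vi≡a) ∈y))))
    ...   | inj₂ (k , _ , yo≡) =
      ⊥-elim (a∉bz (subst (_∈ b ∷ z) (trans (sym yo≡) (trans (sym vi≡) vi≡a)) (omega-∈ b z k)))

Periodic : ∀ {A : Set} → Word∞ A → Set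
Periodic {A} w = Σ (List⁺ A) λ u → Unique (toList u) × (∀ i → w i ≡ omega u i)

record Lasso {A : Set} (P : Word∞ A → Set) : Set where
  field
    x y z    : List A
    a b      : A
    a∉xyz    : a ∉ x ++ y ++ z
    a≢b      : a ≢ b
    b∉z      : b ∉ z
    unique-x : Unique x
    unique-y : Unique y
    unique-z : Unique z
    property : P (lassoWord x a y b z)

mapLasso : ∀ {A : Set} {P Q : Word∞ A → Set} → (∀ {v} → P v → Q v) → Lasso P → Lasso Q
mapLasso P⇒Q L = record { Lasso L ; property = P⇒Q (Lasso.property L) }

module Walks {A : Set} (G : A → A → Set) where

  Walk : Word∞ A → Set
  Walk v = ∀ i → G (v i) (v (suc i))

  WalkBelow : Word∞ A → ℕ → Set
  WalkBelow v n = ∀ {i} → i < n → G (v i) (v (suc i))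

  walkBelow-prefix-⧺ : ∀ k {u v n} → WalkBelow u k → G (u k) (v 0) → WalkBelow v n
                     → WalkBelow (prefix (suc k) u ⧺ v) (suc k + n)
  walkBelow-prefix-⧺ zero    wu e wv {zero}  _         = e
  walkBelow-prefix-⧺ zero    wu e wv {suc i} (s≤s i<n) = wv i<n
  walkBelow-prefix-⧺ (suc k) wu e wv {zero}  _         = wu (s≤s z≤n)
  walkBelow-prefix-⧺ (suc k) wu e wv {suc i} (s≤s i<)  = walkBelow-prefix-⧺ k (wu ∘ s≤s) e wv i<

  walk-prefix-⧺ : ∀ k {u v} → WalkBelow u k → u k ≡ v 0 → Walk v → Walk (prefix k u ⧺ v)
  walk-prefix-⧺ zero    wu e wv = wv
  walk-prefix-⧺ (suc k) {u} {v} wu e wv i =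
    walkBelow-prefix-⧺ k {n = i} (wu ∘ m≤n⇒m≤1+n) (subst (G (u k)) e (wu ≤-refl)) (λ {j} _ → wv j)
                       (s≤s (m≤n+m i k))

  record Cycle (c : Word∞ A) (n : ℕ) : Set where
    field
      injective : InjectiveBelow c (suc n)
      walk      : WalkBelow c (suc n)
      closed    : c (suc n) ≡ c 0

  closed⇒suc-% : ∀ {c : Word∞ A} {n r} → c (suc n) ≡ c 0 → r < suc n → c (suc r) ≡ c (suc r % suc n)
  closed⇒suc-% {c} {n} {r} closed r<p with m≤n⇒m<n∨m≡n r<p
  ... | inj₁ r+1<p  = cong c (sym (m<n⇒m%n≡m r+1<p))
  ... | inj₂ refl   = trans closed (cong c (sym (n%n≡0 (suc n))))

  walk-omega : ∀ {c n} → Cycle c n → Walk (omega (prefix⁺ n c))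
  walk-omega {c} {n} cyc i =
    subst₂ G (sym (omega-prefix⁺ n c i)) (sym (omega-prefix⁺ n c (suc i)))
      (subst (G (c (i % suc n))) (trans (closed⇒suc-% {c} closed r<p) (cong c (sym (suc-% i (suc n)))))
             (walk r<p))
    where
    open Cycle cyc
    r<p = m%n<n i (suc n)

  cycle-lasso : ∀ {u c : Word∞ A} {K n} t → t < K → InjectiveBelow u K → WalkBelow u K
              → Cycle c n → u K ≡ c 0 → u t ∉ prefix (suc n) c
              → Lasso (λ v → v 0 ≡ u 0 × Walk v)
  cycle-lasso {u} {c} {K} {n} t t<K inj wu cyc uK≡c0 ut∉c with l , refl ← m≤n⇒∃[o]m+o≡n t<K = record
    { x        = prefix t u
    ; y        = prefix l (shift t u ∘ suc)
    ; z        = prefix n (c ∘ suc)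
    ; a        = u t
    ; b        = c 0
    ; a∉xyz    = a∉xyz
    ; a≢b      = λ ut≡c0 → ut∉c (here ut≡c0)
    ; b∉z      = All¬⇒¬Any (AllPairs.head unique-c)
    ; unique-x = applyUpTo⁺₁ u t (injectiveBelow-≤ (<⇒≤ t<K) inj)
    ; unique-y = AllPairs.tail unique-ay
    ; unique-z = AllPairs.tail unique-c
    ; property = ⧺-prefix-head t u _ refl , walk-prefix-⧺ t (wu ∘ λ i<t → <-trans i<t t<K) refl walk-ayo
    }
    where
    open Cycle cyc
    unique-c : Unique (prefix (suc n) c)
    unique-c = applyUpTo⁺₁ c (suc n) injective
    unique-ay : Unique (prefix (suc l) (shift t u))
    unique-ay = applyUpTo⁺₁ (shift t u) (suc l) (injectiveBelow-shift t (suc l) (≤-reflexive (+-suc t l)) inj)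
    a∉xyz : u t ∉ prefix t u ++ prefix l (shift t u ∘ suc) ++ prefix n (c ∘ suc)
    a∉xyz ∈xyz with ∈-++⁻ (prefix t u) ∈xyz
    ... | inj₁ ∈x with i , i<t , ut≡ui ← ∈-applyUpTo⁻ u ∈x = inj i<t t<K (sym ut≡ui)
    ... | inj₂ ∈yz with ∈-++⁻ (prefix l (shift t u ∘ suc)) ∈yz
    ...   | inj₁ ∈y = All¬⇒¬Any (AllPairs.head unique-ay) ∈y
    ...   | inj₂ ∈z = ut∉c (there ∈z)
    l+t≡t+l : suc l + t ≡ suc (t + l)
    l+t≡t+l = cong suc (+-comm l t)
    walk-ay : WalkBelow (shift t u) (suc l)
    walk-ay {i} i<l+1 = wu (subst (i + t <_) l+t≡t+l (+-monoˡ-< t i<l+1))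
    walk-ayo : Walk (prefix (suc l) (shift t u) ⧺ omega (prefix⁺ n c))
    walk-ayo = walk-prefix-⧺ (suc l) walk-ay
                 (trans (cong u l+t≡t+l) (trans uK≡c0 (sym (omega-prefix⁺ n c 0)))) (walk-omega cyc)

  repetition-lasso : ∀ {u : Word∞ A} {i k} → 0 < i → i < k → u i ≡ u k
                   → InjectiveBelow u k → WalkBelow u k → Lasso (λ v → v 0 ≡ u 0 × Walk v)
  repetition-lasso {u} {i} 0<i i<k ui≡uk inj wu with n , refl ← m≤n⇒∃[o]m+o≡n i<k =
    cycle-lasso 0 0<i (injectiveBelow-≤ (<⇒≤ i<k) inj) (wu ∘ λ j<i → <-trans j<i i<k) cyc refl u0∉cycle
    where
    i+n<k : ∀ {j} → j < suc n → j + i < suc i + n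
    i+n<k {j} j<n+1 = subst (j + i <_) (cong suc (+-comm n i)) (+-monoˡ-< i j<n+1)
    cyc : Cycle (shift i u) n
    cyc = record
      { injective = injectiveBelow-shift i (suc n) (≤-reflexive (+-suc i n)) inj
      ; walk      = λ j<n+1 → wu (i+n<k j<n+1)
      ; closed    = trans (cong u (cong suc (+-comm n i))) (sym ui≡uk)
      }
    u0∉cycle : u 0 ∉ prefix (suc n) (shift i u)
    u0∉cycle ∈cyc with j , j<n+1 , u0≡ ← ∈-applyUpTo⁻ (shift i u) ∈cyc =
      inj (<-≤-trans 0<i (m≤n+m i j)) (i+n<k j<n+1) u0≡

  skip-lasso : ∀ {w n r s} → Walk w → Cycle w n → suc r < s → s ≤ suc n → G (w r) (w s)
             → Lasso (λ v → v 0 ≡ w 0 × Walk v)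
  skip-lasso {w} {n} {r} {s} ww cyc r+1<s s≤p r→s with e , s+e≡p ← m≤n⇒∃[o]m+o≡n s≤p =
    cycle-lasso (suc r) r+1<p w-injective (λ {i} _ → ww i) skip w-closed w[r+1]∉skip
    where
    open Cycle cyc using () renaming (injective to w-injective; closed to w-closed)
    c = prefix (suc r) w ⧺ shift s w
    r+1<p = <-≤-trans r+1<s s≤p
    j+s<p : ∀ {j} → j < e → j + s < suc n
    j+s<p {j} j<e = subst (j + s <_) (trans (+-comm e s) s+e≡p) (+-monoˡ-< s j<e)
    r+1<j+s : ∀ j → suc r < j + s
    r+1<j+s j = <-≤-trans r+1<s (m≤n+m s j)
    position : ∀ {i} → i < suc r + e
             → (i < suc r × c i ≡ w i) ⊎ ∃ λ j → j < e × i ≡ suc r + j × c i ≡ w (j + s)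
    position {i} i<r+1+e with ⧺-prefix-cases (suc r) w (shift s w) i
    ... | inj₁ below = inj₁ below
    ... | inj₂ (j , refl , eq) = inj₂ (j , +-cancelˡ-< (suc r) j e i<r+1+e , refl , eq)
    skip-injective : InjectiveBelow c (suc r + e)
    skip-injective {i} {i′} i<i′ i′<K ci≡ci′ with position (<-trans i<i′ i′<K) | position i′<K
    ... | inj₁ (_ , ci≡) | inj₁ (i′<r+1 , ci′≡) =
      w-injective i<i′ (<-trans i′<r+1 r+1<p) (trans (sym ci≡) (trans ci≡ci′ ci′≡))
    ... | inj₁ (i<r+1 , ci≡) | inj₂ (j′ , j′<e , _ , ci′≡) =
      w-injective (<-trans i<r+1 (r+1<j+s j′)) (j+s<p j′<e) (trans (sym ci≡) (trans ci≡ci′ ci′≡))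
    ... | inj₂ (j , _ , refl , _) | inj₁ (i′<r+1 , _) =
      <-asym i<i′ (<-≤-trans i′<r+1 (m≤m+n (suc r) j))
    ... | inj₂ (j , _ , refl , ci≡) | inj₂ (j′ , j′<e , refl , ci′≡) =
      w-injective (+-monoˡ-< s (+-cancelˡ-< (suc r) j j′ i<i′)) (j+s<p j′<e)
                  (trans (sym ci≡) (trans ci≡ci′ ci′≡))
    skip : Cycle c (r + e)
    skip = record
      { injective = skip-injective
      ; walk      = walkBelow-prefix-⧺ r (λ {i} _ → ww i) r→s (λ {j} _ → ww (j + s))
      ; closed    = trans (⧺-prefix-+ (suc r) w (shift s w) e)
                          (trans (cong w (trans (+-comm e s) s+e≡p)) w-closed)
      }
    w[r+1]∉skip : w (suc r) ∉ prefix (suc (r + e)) c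
    w[r+1]∉skip ∈skip with i , i<K , w[r+1]≡ci ← ∈-applyUpTo⁻ c ∈skip with position i<K
    ... | inj₁ (i<r+1 , ci≡) = w-injective i<r+1 r+1<p (sym (trans w[r+1]≡ci ci≡))
    ... | inj₂ (j , j<e , _ , ci≡) = w-injective (r+1<j+s j) (j+s<p j<e) (trans w[r+1]≡ci ci≡)

  HasPath : ℕ → A → Set
  HasPath zero    d = ⊤
  HasPath (suc n) d = ∃ λ e → G d e × HasPath n e

  walk⇒hasPath : ∀ {w} → Walk w → ∀ n i → HasPath n (w i)
  walk⇒hasPath ww zero    i = tt
  walk⇒hasPath ww (suc n) i = _ , ww i , walk⇒hasPath ww n (suc i)

  -- constant after the end of the path
  pathWord : ∀ n d → HasPath n d → Word∞ A
  pathWord n       d _              zero    = d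
  pathWord zero    d _              (suc i) = d
  pathWord (suc n) d (e , _ , path) (suc i) = pathWord n e path i

  pathWord-walk : ∀ n d (path : HasPath n d) → WalkBelow (pathWord n d path) n
  pathWord-walk (suc n) d (e , d→e , path) {zero}  _         = d→e
  pathWord-walk (suc n) d (e , d→e , path) {suc i} (s≤s i<n) = pathWord-walk n e path i<n

  cycle-periodic : ∀ {w n} N → Walk w → Cycle w n
                 → (∀ {r d} → r < suc n → G (w r) d → HasPath N d → d ≡ w (suc r)) → Periodic w
  cycle-periodic {w} {n} N ww cyc no-exit = prefix⁺ n w , applyUpTo⁺₁ w (suc n) injective ,
    λ i → trans (w≡w[%] i) (sym (omega-prefix⁺ n w i))
    where
    open Cycle cyc
    w≡w[%] : ∀ i → w i ≡ w (i % suc n)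
    w≡w[%] zero    = refl
    w≡w[%] (suc i) = begin
      w (suc i)                   ≡⟨ no-exit r<p (subst (λ a → G a (w (suc i))) (w≡w[%] i) (ww i))
                                                 (walk⇒hasPath ww N (suc i)) ⟩
      w (suc (i % suc n))         ≡⟨ closed⇒suc-% {w} closed r<p ⟩
      w (suc (i % suc n) % suc n) ≡⟨ cong w (sym (suc-% i (suc n))) ⟩
      w (suc i % suc n)           ∎
      where
      open ≡-Reasoning
      r<p = m%n<n i (suc n)

module _ {P : ℕ → Set} (P? : ∀ n → Dec (P n)) where

  private
    search : ∀ n → (∃ λ k → k < n × P k × (∀ {j} → j < k → ¬ P j)) ⊎ (∀ {j} → j < n → ¬ P j)
    search zero = inj₂ λ ()
    search (suc n) with search n
    ... | inj₁ (k , k<n , pk , none-below) = inj₁ (k , m<n⇒m<1+n k<n , pk , none-below)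
    ... | inj₂ none-below with P? n
    ...   | yes pn = inj₁ (n , ≤-refl , pn , none-below)
    ...   | no ¬pn = inj₂ λ j<n+1 → [ none-below , (λ { refl → ¬pn }) ]′ (m<1+n⇒m<n∨m≡n j<n+1)

  least : ∀ {N} → P N → ∃ λ k → k ≤ N × P k × (∀ {j} → j < k → ¬ P j)
  least {N} pN with search (suc N)
  ... | inj₁ (k , k<N+1 , pk , none-below) = k , ≤-pred k<N+1 , pk , none-below
  ... | inj₂ none-below                  = ⊥-elim (none-below ≤-refl pN)

first-repetition : ∀ {m} (g : Word∞ (Fin m))
                 → ∃ λ k → k ≤ m × (∃ λ i → i < k × g i ≡ g k) × InjectiveBelow g k
first-repetition {m} g
  with i , j , i<j , gi≡gj ← pigeonhole (n<1+n m) (g ∘ toℕ)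
  with k , k≤j , repeats , none-below
         ← least (λ k → anyUpTo? (λ i → g i ≟ᶠ g k) k) (toℕ i , i<j , gi≡gj)
  = k , ≤-trans k≤j (≤-pred (toℕ<n j)) , repeats , λ i<j j<k gi≡gj → none-below j<k (_ , i<j , gi≡gj)

module FiniteGraph {m} (G : Fin m → Fin m → Set) (G? : ∀ a b → Dec (G a b)) where
  open Walks G
  open import Data.List.Membership.DecPropositional (_≟ᶠ_ {m}) using (_∈?_; _∉?_)

  hasPath? : ∀ n d → Dec (HasPath n d)
  hasPath? zero    d = yes tt
  hasPath? (suc n) d = any? λ e → G? d e ×-dec hasPath? n e


  -- U follows the cycle up to w r, then d and a path of length m. If its first repetition is
  -- U 0 = U k, this closes a second cycle through w 0. If that cycle visits a letter off the cycle of w,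
  -- the letter occurs once in a lasso around w's cycle; otherwise d = w s further along the cycle,
  -- and the shortcut w 0 ⋯ w r w s ⋯ w n misses w (suc r).
  deviation-lasso : ∀ {w n r d} → Walk w → Cycle w n → r < suc n
                  → G (w r) d → d ≢ w (suc r) → HasPath m d
                  → Lasso (λ v → v 0 ≡ w 0 × Walk v)
  deviation-lasso {w} {n} {r} {d} ww cyc r<p r→d d≢w[r+1] path = from-repetition (first-repetition U)
    where
    open Cycle cyc using () renaming (injective to w-injective; closed to w-closed)
    h = pathWord m d path
    U = prefix (suc r) w ⧺ h
    U≡w : ∀ {i} → i < suc r → U i ≡ w i
    U≡w = ⧺-prefix w h
    U[r+1]≡d : U (suc r) ≡ d
    U[r+1]≡d = trans (cong U (sym (+-identityʳ (suc r)))) (⧺-prefix-+ (suc r) w h 0)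
    walkU : ∀ {k} → k ≤ m → WalkBelow U k
    walkU k≤m i<k = walkBelow-prefix-⧺ r (λ {i} _ → ww i) r→d (pathWord-walk m d path)
                                       (<-≤-trans i<k (≤-trans k≤m (m≤n+m m (suc r))))
    target : ∀ {k} → 0 < k → U 0 ≡ U k → InjectiveBelow U k
           → (∀ {t} → t < k → U t ∈ prefix (suc n) w)
           → ∃ λ s → suc r < s × s ≤ suc n × d ≡ w s
    target {k} 0<k U0≡Uk U-injective inside with <-cmp k (suc r)
    ... | tri< k<r+1 _ _ = ⊥-elim (w-injective 0<k (<-≤-trans k<r+1 r<p) (trans U0≡Uk (U≡w k<r+1)))
    ... | tri≈ _ refl _ with m≤n⇒m<n∨m≡n r<p
    ...   | inj₁ r+1<p = suc n , r+1<p , ≤-refl , trans (sym U[r+1]≡d) (trans (sym U0≡Uk) (sym w-closed))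
    ...   | inj₂ refl  = ⊥-elim (d≢w[r+1] (trans (sym U[r+1]≡d) (trans (sym U0≡Uk) (sym w-closed))))
    target {k} 0<k U0≡Uk U-injective inside | tri> _ _ r+1<k
      with s , s<p , U[r+1]≡ws ← ∈-applyUpTo⁻ w (inside r+1<k) with <-cmp s (suc r)
    ... | tri< s<r+1 _ _ = ⊥-elim (U-injective s<r+1 r+1<k (trans (U≡w s<r+1) (sym U[r+1]≡ws)))
    ... | tri≈ _ refl _  = ⊥-elim (d≢w[r+1] (trans (sym U[r+1]≡d) U[r+1]≡ws))
    ... | tri> _ _ r+1<s = s , r+1<s , <⇒≤ s<p , trans (sym U[r+1]≡d) U[r+1]≡ws
    from-repetition : (∃ λ k → k ≤ m × (∃ λ i → i < k × U i ≡ U k) × InjectiveBelow U k)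
                    → Lasso (λ v → v 0 ≡ w 0 × Walk v)
    from-repetition (k , k≤m , (suc i , i<k , Ui≡Uk) , U-injective) =
      repetition-lasso (s≤s z≤n) i<k Ui≡Uk U-injective (walkU k≤m)
    from-repetition (k , k≤m , (zero , 0<k , U0≡Uk) , U-injective)
      with anyUpTo? (λ t → U t ∉? prefix (suc n) w) k
    ... | yes (t , t<k , Ut∉w) = cycle-lasso t t<k U-injective (walkU k≤m) cyc (sym U0≡Uk) Ut∉w
    ... | no none-outside =
      let s , r+1<s , s≤p , d≡ws = target 0<k U0≡Uk U-injective λ {t} t<k →
            decidable-stable (U t ∈? prefix (suc n) w) λ Ut∉w → none-outside (t , t<k , Ut∉w)
      in skip-lasso ww cyc r+1<s s≤p (subst (G (w r)) d≡ws r→d)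

  cycle-periodic-or-lasso : ∀ {w n} → Walk w → Cycle w n
                          → Periodic w ⊎ Lasso (λ v → v 0 ≡ w 0 × Walk v)
  cycle-periodic-or-lasso {w} {n} ww cyc
    with anyUpTo? (λ r → any? λ d → G? (w r) d ×-dec ¬? (d ≟ᶠ w (suc r)) ×-dec hasPath? m d) (suc n)
  ... | yes (r , r<p , d , r→d , d≢w[r+1] , path) = inj₂ (deviation-lasso ww cyc r<p r→d d≢w[r+1] path)
  ... | no no-deviation = inj₁ (cycle-periodic m ww cyc λ {r} {d} r<p r→d path →
          decidable-stable (d ≟ᶠ w (suc r)) λ d≢w[r+1] →
            no-deviation (r , r<p , d , r→d , d≢w[r+1] , path))

  periodic-or-lasso : ∀ {w} → Walk w → Periodic w ⊎ Lasso (λ v → v 0 ≡ w 0 × Walk v)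
  periodic-or-lasso {w} ww with first-repetition w
  ... | k , _ , (suc i , i<k , wi≡wk) , w-injective =
    inj₂ (repetition-lasso (s≤s z≤n) i<k wi≡wk w-injective (λ {j} _ → ww j))
  ... | suc n , _ , (zero , _ , w0≡wp) , w-injective =
    cycle-periodic-or-lasso ww (record { injective = w-injective ; walk = λ {j} _ → ww j ; closed = sym w0≡wp })

module Images {A B : Set} (f : A → List⁺ B) where

  ∣f∣ : A → ℕ
  ∣f∣ α = length⁺ (f α)

  ∣f∣-positive : ∀ α → 0 < ∣f∣ α
  ∣f∣-positive α with f α
  ... | _ ∷⁺ _ = s≤s z≤n

  start : Word∞ A → ℕ → ℕ
  start u zero    = 0
  start u (suc i) = ∣f∣ (u 0) + start (u ∘ suc) i

  image-++ : ∀ (u : Word∞ A) s → image f u (∣f∣ (u 0) + s) ≡ image f (u ∘ suc) s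
  image-++ u s = go-skip (head (f (u 0))) (tail (f (u 0)))
    where
    go-skip : ∀ b bs → go f (suc (length bs) + s) b bs (u ∘ suc) ≡ image f (u ∘ suc) s
    go-skip b []       = refl
    go-skip b (c ∷ cs) = go-skip c cs

  image-head : ∀ {u u′ : Word∞ A} {s} → s < ∣f∣ (u 0) → u 0 ≡ u′ 0 → image f u s ≡ image f u′ s
  image-head {u} {u′} {s} s<∣f∣ u0≡u′0 =
    trans (go-head (head (f (u 0))) (tail (f (u 0))) s s<∣f∣)
          (cong (λ α → go f s (head (f α)) (tail (f α)) (u′ ∘ suc)) u0≡u′0)
    where
    go-head : ∀ b bs s → s < suc (length bs) → go f s b bs (u ∘ suc) ≡ go f s b bs (u′ ∘ suc)
    go-head b bs       zero    _           = refl
    go-head b (c ∷ cs) (suc s) (s≤s s<∣p∣) = go-head c cs s s<∣p∣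

  image-local : ∀ k {u u′ : Word∞ A} {s} → s < start u k → (∀ {i} → i < k → u i ≡ u′ i)
              → image f u s ≡ image f u′ s
  image-local (suc k) {u} {u′} {s} s<start u≡u′ with s <? ∣f∣ (u 0)
  ... | yes s<∣f∣ = image-head {u} {u′} s<∣f∣ (u≡u′ (s≤s z≤n))
  ... | no s≮∣f∣ with s′ , refl ← m≤n⇒∃[o]m+o≡n (≮⇒≥ s≮∣f∣) = begin
    image f u (∣f∣ (u 0) + s′)   ≡⟨ image-++ u s′ ⟩
    image f (u ∘ suc) s′         ≡⟨ image-local k (+-cancelˡ-< (∣f∣ (u 0)) s′ _ s<start) (u≡u′ ∘ s≤s) ⟩
    image f (u′ ∘ suc) s′        ≡⟨ image-++ u′ s′ ⟨
    image f u′ (∣f∣ (u′ 0) + s′) ≡⟨ cong (λ α → image f u′ (∣f∣ α + s′)) (u≡u′ (s≤s z≤n)) ⟨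
    image f u′ (∣f∣ (u 0) + s′)  ∎
    where open ≡-Reasoning

  LetterPosition : Word∞ A → ℕ → Set
  LetterPosition u P = ∃ λ i → ∃ λ t → t < ∣f∣ (u i) × start u i + t ≡ P

  letterPosition : ∀ P (u : Word∞ A) → LetterPosition u P
  letterPosition = <-rec _ step
    where
    step : ∀ P → (∀ {P′} → P′ < P → ∀ u → LetterPosition u P′) → ∀ u → LetterPosition u P
    step P rec u with P <? ∣f∣ (u 0)
    ... | yes P<∣f∣ = 0 , P , P<∣f∣ , refl
    ... | no P≮∣f∣ with P′ , refl ← m≤n⇒∃[o]m+o≡n (≮⇒≥ P≮∣f∣)
                   with i , t , t< , eq ← rec (m<n+m P′ (∣f∣-positive (u 0))) (u ∘ suc) =
      suc i , t , t< , trans (+-assoc (∣f∣ (u 0)) (start (u ∘ suc) i) t) (cong (∣f∣ (u 0) +_) eq)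

  pair : A → A → Word∞ A
  pair β α = (β ∷ []) ⧺ λ _ → α

  image-window : ∀ (u : Word∞ A) i {s} → s < ∣f∣ (u i) + ∣f∣ (u (suc i))
               → image f u (start u i + s) ≡ image f (pair (u i) (u (suc i))) s
  image-window u zero {s} s<∣f∣+∣f∣ =
    image-local 2 (subst (s <_) (cong (∣f∣ (u 0) +_) (sym (+-identityʳ _))) s<∣f∣+∣f∣) agree
    where
    agree : ∀ {i} → i < 2 → u i ≡ pair (u 0) (u 1) i
    agree {zero}        _ = refl
    agree {suc zero}    _ = refl
    agree {suc (suc i)} (s≤s (s≤s ()))
  image-window u (suc i) {s} s<∣f∣+∣f∣ = begin
    image f u ((∣f∣ (u 0) + start (u ∘ suc) i) + s)   ≡⟨ cong (image f u) (+-assoc (∣f∣ (u 0)) _ s) ⟩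
    image f u (∣f∣ (u 0) + (start (u ∘ suc) i + s))   ≡⟨ image-++ u _ ⟩
    image f (u ∘ suc) (start (u ∘ suc) i + s)         ≡⟨ image-window (u ∘ suc) i s<∣f∣+∣f∣ ⟩
    image f (pair (u (suc i)) (u (suc (suc i)))) s    ∎
    where open ≡-Reasoning

  image-first : ∀ (u : Word∞ A) {s} → s < ∣f∣ (u 0) → image f u s ≡ image f (λ _ → u 0) s
  image-first u {s} s<∣f∣ = image-head {u} {λ _ → u 0} s<∣f∣ refl

module QuasiperiodicImages {A B : Set} (_≟_ : DecidableEquality B) (f : A → List⁺ B) (q : List B) where
  open Images f

  private
    ℓ = length q

  CoveredWithin : Word∞ B → ℕ → ℕ → Set
  CoveredWithin x N t = ∃ λ j → j ≤ t × t < j + ℓ × j + ℓ ≤ N × OccursAt q x j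

  Initial : A → Set
  Initial α = ∀ {t} → t < ℓ → CoveredWithin (image f λ _ → α) (∣f∣ α) t

  -- Shifted by start w i, the ranges of t for consecutive letters of w tile all positions ≥ ℓ of f(w).
  Link : A → A → Set
  Link β α = ∀ {t} → t < ∣f∣ β + ℓ → ℓ ≤ t → CoveredWithin (image f (pair β α)) (∣f∣ β + ∣f∣ α) t

  coveredWithin? : ∀ x N t → Dec (CoveredWithin x N t)
  coveredWithin? x N t =
    map′ (λ (j , j<t+1 , rest) → j , ≤-pred j<t+1 , rest) (λ (j , j≤t , rest) → j , s≤s j≤t , rest)
         (anyUpTo? (λ j → t <? j + ℓ ×-dec j + ℓ ≤? N ×-dec all? λ k → x (j + toℕ k) ≟ lookup q k)
                   (suc t))

  link? : ∀ β α → Dec (Link β α)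
  link? β α =
    allUpTo? (λ t → ℓ ≤? t →-dec coveredWithin? (image f (pair β α)) (∣f∣ β + ∣f∣ α) t) (∣f∣ β + ℓ)

  local⇒quasiperiodic : ∀ {v} → Initial (v 0) → (∀ i → Link (v i) (v (suc i)))
                      → QuasiperiodicBy q (image f v)
  local⇒quasiperiodic {v} initial link P with P <? ℓ
  ... | yes P<ℓ with j , j≤P , P<j+ℓ , j+ℓ≤∣f∣ , occ ← initial P<ℓ =
    j , j≤P , P<j+ℓ , λ k → trans (image-first v (<-≤-trans (+-monoʳ-< j (toℕ<n k)) j+ℓ≤∣f∣)) (occ k)
  ... | no P≮ℓ with P′ , refl ← m≤n⇒∃[o]m+o≡n (≮⇒≥ P≮ℓ)
               with i , t , t<∣f∣ , st+t≡P′ ← letterPosition P′ v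
               with j , j≤t+ℓ , t+ℓ<j+ℓ , j+ℓ≤N , occ ← link i (+-monoˡ-< ℓ t<∣f∣) (m≤n+m ℓ t) =
    st + j , subst (st + j ≤_) P≡ (+-monoʳ-≤ st j≤t+ℓ) ,
    subst₂ _<_ P≡ (sym (+-assoc st j ℓ)) (+-monoʳ-< st t+ℓ<j+ℓ) ,
    λ k → trans (cong (image f v) (+-assoc st j (toℕ k)))
                (trans (image-window v i (<-≤-trans (+-monoʳ-< j (toℕ<n k)) j+ℓ≤N)) (occ k))
    where
    st = start v i
    P≡ : st + (t + ℓ) ≡ ℓ + P′
    P≡ = trans (sym (+-assoc st t ℓ)) (trans (cong (_+ ℓ) st+t≡P′) (+-comm P′ ℓ))

  module _ (long : ∀ α → 2 * ℓ ≤ ∣f∣ α) {w : Word∞ A} (qp : QuasiperiodicBy q (image f w)) where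

    private
      ℓ+ℓ≤∣f∣ : ∀ α → ℓ + ℓ ≤ ∣f∣ α
      ℓ+ℓ≤∣f∣ α = subst (_≤ ∣f∣ α) (cong (ℓ +_) (+-identityʳ ℓ)) (long α)

    quasiperiodic⇒initial : Initial (w 0)
    quasiperiodic⇒initial {t} t<ℓ with j , j≤t , t<j+ℓ , occ ← qp t =
      j , j≤t , t<j+ℓ , j+ℓ≤∣f∣ ,
      λ k → trans (sym (image-first w (<-≤-trans (+-monoʳ-< j (toℕ<n k)) j+ℓ≤∣f∣))) (occ k)
      where
      j+ℓ≤∣f∣ : j + ℓ ≤ ∣f∣ (w 0)
      j+ℓ≤∣f∣ = ≤-trans (+-monoˡ-≤ ℓ (≤-trans j≤t (<⇒≤ t<ℓ))) (ℓ+ℓ≤∣f∣ (w 0))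

    quasiperiodic⇒link : ∀ i → Link (w i) (w (suc i))
    quasiperiodic⇒link i {t} t<∣f∣+ℓ ℓ≤t with J , J≤P , P<J+ℓ , occ ← qp (start w i + t)
      with j , refl ← m≤n⇒∃[o]m+o≡n
                        (<⇒≤ (+-cancelʳ-< ℓ (start w i) J (≤-<-trans (+-monoʳ-≤ (start w i) ℓ≤t) P<J+ℓ))) =
      j , +-cancelˡ-≤ st j t J≤P , +-cancelˡ-< st t (j + ℓ) (subst (st + t <_) (+-assoc st j ℓ) P<J+ℓ) ,
      j+ℓ≤N ,
      λ k → trans (sym (image-window w i (<-≤-trans (+-monoʳ-< j (toℕ<n k)) j+ℓ≤N)))
                  (trans (cong (image f w) (sym (+-assoc st j (toℕ k)))) (occ k))
      where
      st = start w i
      j+ℓ≤N : j + ℓ ≤ ∣f∣ (w i) + ∣f∣ (w (suc i))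
      j+ℓ≤N = ≤-trans (+-monoˡ-≤ ℓ (+-cancelˡ-≤ st j t J≤P))
                (≤-trans (<⇒≤ (+-monoˡ-< ℓ t<∣f∣+ℓ))
                  (subst (_≤ ∣f∣ (w i) + ∣f∣ (w (suc i))) (sym (+-assoc (∣f∣ (w i)) ℓ ℓ))
                         (+-monoʳ-≤ (∣f∣ (w i)) (ℓ+ℓ≤∣f∣ (w (suc i))))))

periodic-or-quasiperiodic-lasso : ∀ {m n} (f : Fin m → List⁺ (Fin n)) q {w}
  → (∀ α → 2 * length q ≤ length⁺ (f α)) → QuasiperiodicBy q (image f w)
  → Periodic w ⊎ Lasso (λ v → QuasiperiodicBy q (image f v))
periodic-or-quasiperiodic-lasso f q {w} long qp =
  Sum.map₂ (mapLasso λ (v0≡w0 , walk) →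
              local⇒quasiperiodic (subst Initial (sym v0≡w0) (quasiperiodic⇒initial long {w} qp)) walk)
           (periodic-or-lasso (quasiperiodic⇒link long qp))
  where
  open QuasiperiodicImages _≟ᶠ_ f q
  open FiniteGraph Link link?

lemma6p5 : (m n : ℕ) (f : Fin m → List⁺ (Fin n)) (w : Word∞ (Fin m)) (q : List (Fin n))
    → q ≢ []
    → (∀ α → 2 * length q ≤ length⁺ (f α))
    → QuasiperiodicBy q (image f w)
    → (Σ (List⁺ (Fin m)) λ u → Unique (toList u) × (∀ i → w i ≡ omega u i))
      ⊎ (Σ (List (Fin m)) λ x → Σ (List (Fin m)) λ y → Σ (List (Fin m)) λ z →
         Σ (Fin m) λ a → Σ (Fin m) λ b →
           a ∉ x ++ y ++ z × b ∉ z
           × ¬ Quasiperiodic (x ⧺ (a ∷ y) ⧺ omega (b ∷⁺ z))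
           × QuasiperiodicBy q (image f (x ⧺ (a ∷ y) ⧺ omega (b ∷⁺ z)))
           × Unique x × Unique y × Unique z)
lemma6p5 m n f w q _ long qp with periodic-or-quasiperiodic-lasso f q {w} long qp
... | inj₁ periodic = inj₁ periodic
... | inj₂ L = inj₂ (x , y , z , a , b , a∉xyz , b∉z ,
                     lassoWord-¬quasiperiodic {x = x} {y} {z} a∉xyz a≢b , property ,
                     unique-x , unique-y , unique-z)
  where open Lasso L
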